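{- Let $L$ be the digraph with vertex set $\mathbb{Z}\times\{ -1,0,1\}$ in which $((i,x),(j,y))$ is an edge if and only if $j=i+1$ and either $i$ is even, or $i$ is odd and $x+y\neq 0$. Let $\varphi^1,\varphi^2:V(L)\to\mathbb{Z}$ be given by $\varphi^1((i,x))=i$ and $\varphi^2((i,x))=i+1$ (both are epimorphisms of $L$ onto $Z$). Let $D=L\,{}_{\varphi^1}\!\!\times_{\varphi^2}L$ be the layerwise direct product, i.e. the digraph with vertex set $\{(u,v)\in V(L)\times V(L)\mid \varphi^1(u)=\varphi^2(v)\}$ and with $((a,b),(u,v))$ an edge if and only if $(a,u)$ and $(b,v)$ are both edges of $L$. Then $D$ is highly arc transitive.
   Context: Let $Z$ be the digraph with vertex set $\mathbb{Z}$ and edges $(i,i+1)$. An $n$-arc in a digraph is a sequence $(e_i)_{i=0,\dots,n-1}$ of directed edges $e_i=(x_{e_i},y_{e_i})$ with $y_{e_i}=x_{e_{i+1}}$ for all $i$. A digraph is highly arc transitive if for every $n\in\mathbb{N}$ its automorphism group acts transitively on the nonempty set of its $n$-arcs. -}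

module Defs where

open import Level using (0ℓ)
open import Data.Nat using (ℕ; suc)
open import Data.Fin using (Fin; toℕ)
open import Data.Integer using (ℤ; _+_; 0ℤ; 1ℤ; -1ℤ)
open import Data.Product using (Σ; _×_; _,_; proj₁; proj₂; ∃)
open import Data.Sum using (_⊎_)
open import Function.Bundles using (_↔_; Inverse)
open import Relation.Binary.PropositionalEquality using (_≡_; _≢_)

record Digraph : Set₁ where
  field
    V : Set
    E : V → V → Set
open Digraph public

record Arc (G : Digraph) (n : ℕ) : Set where
  field
    edge    : Fin n → V G × V G
    isEdge  : ∀ i → E G (proj₁ (edge i)) (proj₂ (edge i))
    consec  : ∀ (i j : Fin n) → toℕ j ≡ suc (toℕ i) →
              proj₂ (edge i) ≡ proj₁ (edge j)
open Arc public

record Automorphism (G : Digraph) : Set where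
  field
    bij      : V G ↔ V G
    preserve : ∀ x y → E G x y → E G (Inverse.to bij x) (Inverse.to bij y)
    reflect  : ∀ x y → E G (Inverse.to bij x) (Inverse.to bij y) → E G x y
open Automorphism public

_maps_to_ : ∀ {G n} → Automorphism G → Arc G n → Arc G n → Set
_maps_to_ {G} {n} f α β =
  ∀ i → (Inverse.to (bij f) (proj₁ (edge α i)) ≡ proj₁ (edge β i))
      × (Inverse.to (bij f) (proj₂ (edge α i)) ≡ proj₂ (edge β i))

HighlyArcTransitive : Digraph → Set
HighlyArcTransitive G =
  ∀ (n : ℕ) → Arc G n ×
    (∀ (α β : Arc G n) → Σ (Automorphism G) λ f → f maps α to β)

data Three : Set where
  m1 z0 p1 : Three

val : Three → ℤ
val m1 = -1ℤ
val z0 = 0ℤ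
val p1 = 1ℤ

data Even : ℤ → Set where
  even : ∀ k → Even (k + k)

data Odd : ℤ → Set where
  odd : ∀ k → Odd (1ℤ + (k + k))

L : Digraph
L = record
  { V = ℤ × Three
  ; E = λ { (i , x) (j , y) → (j ≡ i + 1ℤ) × (Even i ⊎ (Odd i × (val x + val y ≢ 0ℤ))) }
  }

φ¹ φ² : ℤ × Three → ℤ
φ¹ (i , x) = i
φ² (i , x) = i + 1ℤ

D : Digraph
D = record
  { V = Σ ((ℤ × Three) × (ℤ × Three)) (λ { (u , v) → φ¹ u ≡ φ² v })
  ; E = λ { ((a , b) , _) ((u , v) , _) → E L a u × E L b v }
  }

-- An automorphism of L may shift all layers by an even amount s and permute each layer, subject
-- only to the edges leaving an odd layer i, where x is adjacent to y iff y ≠ −x: the permutation of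
-- layer i + 1 must be the conjugate by negation of that of layer i. As the symmetric group on
-- {−1, 0, 1} is sharply 2-transitive, such a map can send any bi-infinite path of L onto any other,
-- shifted by any even s. An n-arc of D is a pair of n-walks of L, the first one layer above the
-- second, and every walk extends to a bi-infinite path. Two n-arcs whose first walks start t layers
-- apart are therefore matched by (u , v) ↦ (g u , h v) with g, h shifting by t if t is even, and
-- by (u , v) ↦ (g v , h u) with g, h shifting by t + 1 and t − 1 if t is odd.
module Submission where

open import Defs
open import Axiom.UniquenessOfIdentityProofs using (module Decidable⇒UIP)
open import Data.Bool using (if_then_else_)
open import Data.Empty using (⊥-elim)
import Data.Fin as Fin
import Data.Fin.Properties as Finₚ
open import Data.Integer using (ℤ; +_; -[1+_]; -_; _+_; _-_; _*_; ∣_∣; 0ℤ; 1ℤ; -1ℤ)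
import Data.Integer.Properties as ℤₚ
open import Algebra.Properties.AbelianGroup ℤₚ.+-0-abelianGroup using (∙-cancelʳ)
open import Data.Integer.Tactic.RingSolver using (solve-∀)
open import Data.Nat as ℕ using (ℕ; zero; suc)
open import Data.Nat.Divisibility using (_∣_; ∣1⇒≡1; m∣m*n)
import Data.Nat.Properties as ℕₚ
open import Data.Product using (Σ; _×_; _,_; proj₁; proj₂)
open import Data.Product.Algebra using (×-comm)
open import Data.Product.Function.NonDependent.Propositional using (_×-↔_)
open import Data.Sum using (_⊎_; inj₁; inj₂)
open import Function using (case_of_)
open import Function.Bundles using (_↔_; _⇔_; Inverse; Injection; Equivalence; mk↔ₛ′; mk⇔)
open import Function.Construct.Composition using (_↔-∘_)
open import Function.Construct.Identity using (↔-id)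
open import Function.Properties.Inverse using (↔⇒↣)
open import Relation.Binary.Definitions using (DecidableEquality)
open import Relation.Binary.PropositionalEquality
open import Relation.Nullary using (¬_; Dec; yes; no; does; ¬?)
open import Relation.Nullary.Decidable using (from-yes; _→-dec_)
open import Relation.Unary using (Decidable)

open Inverse using (to; from; strictlyInverseˡ; strictlyInverseʳ)

+-right-comm : ∀ i j k → i + j + k ≡ i + k + j
+-right-comm = solve-∀

i+j-j≡i : ∀ i j → i + j - j ≡ i
i+j-j≡i = solve-∀

i-j+j≡i : ∀ i j → i - j + j ≡ i
i-j+j≡i = solve-∀

i+j-i≡j : ∀ i j → i + j - i ≡ j
i+j-i≡j = solve-∀

i+[j-i]≡j : ∀ i j → i + (j - i) ≡ j
i+[j-i]≡j = solve-∀

i+i≢1 : ∀ i → i + i ≢ 1ℤ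
i+i≢1 i i+i≡1 = case ∣1⇒≡1 2∣1 of λ ()
  where
  double : ∀ i → + 2 * i ≡ i + i
  double = solve-∀
  2∣1 : 2 ∣ 1
  2∣1 = subst (2 ∣_) (trans (sym (ℤₚ.abs-* (+ 2) i)) (cong ∣_∣ (trans (double i) i+i≡1)))
          (m∣m*n ∣ i ∣)

even⇒¬odd : ∀ {i} → Even i → ¬ Odd i
even⇒¬odd (even k) o = not-double o refl
  where
  open ≡-Reasoning
  difference : ∀ k l → (k - l) + (k - l) ≡ (k + k) - (l + l)
  difference = solve-∀
  not-double : ∀ {i} → Odd i → i ≢ k + k
  not-double (odd l) eq = i+i≢1 (k - l) (begin
    (k - l) + (k - l)       ≡⟨ difference k l ⟩
    (k + k) - (l + l)       ≡⟨ cong (_- (l + l)) eq ⟨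
    1ℤ + (l + l) - (l + l)  ≡⟨ i+j-j≡i 1ℤ (l + l) ⟩
    1ℤ                      ∎)

even+even : ∀ {i j} → Even i → Even j → Even (i + j)
even+even (even k) (even l) = subst Even (regroup k l) (even (k + l))
  where
  regroup : ∀ k l → (k + l) + (k + l) ≡ (k + k) + (l + l)
  regroup = solve-∀

even+odd : ∀ {i j} → Even i → Odd j → Odd (i + j)
even+odd (even k) (odd l) = subst Odd (regroup k l) (odd (k + l))
  where
  regroup : ∀ k l → 1ℤ + ((k + l) + (k + l)) ≡ (k + k) + (1ℤ + (l + l))
  regroup = solve-∀

odd+even : ∀ {i j} → Odd i → Even j → Odd (i + j)
odd+even {i} {j} o e = subst Odd (ℤₚ.+-comm j i) (even+odd e o)

odd+odd : ∀ {i j} → Odd i → Odd j → Even (i + j)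
odd+odd (odd k) (odd l) = subst Even (regroup k l) (even (1ℤ + k + l))
  where
  regroup : ∀ k l → (1ℤ + k + l) + (1ℤ + k + l) ≡ (1ℤ + (k + k)) + (1ℤ + (l + l))
  regroup = solve-∀

odd-1 : Odd 1ℤ
odd-1 = odd 0ℤ

odd-[-1] : Odd -1ℤ
odd-[-1] = odd -1ℤ

even-or-odd : ∀ i → Even i ⊎ Odd i
even-or-odd (+ zero) = inj₁ (even 0ℤ)
even-or-odd (+ suc n) with even-or-odd (+ n)
... | inj₁ e = inj₂ (odd+even odd-1 e)
... | inj₂ o = inj₁ (odd+odd odd-1 o)
even-or-odd -[1+ zero ] = inj₂ odd-[-1]
even-or-odd -[1+ suc n ] with even-or-odd -[1+ n ]
... | inj₁ e = inj₂ (odd+even odd-[-1] e)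
... | inj₂ o = inj₁ (odd+odd odd-[-1] o)

odd+even-cancel : ∀ {i s} → Even s → Odd (i + s) → Odd i
odd+even-cancel {i} s-even o with even-or-odd i
... | inj₁ e  = ⊥-elim (even⇒¬odd (even+even e s-even) o)
... | inj₂ o′ = o′

neg : Three → Three
neg m1 = p1
neg z0 = z0
neg p1 = m1

neg-involutive : ∀ x → neg (neg x) ≡ x
neg-involutive m1 = refl
neg-involutive z0 = refl
neg-involutive p1 = refl

neg↔ : Three ↔ Three
neg↔ = mk↔ₛ′ neg neg neg-involutive neg-involutive

_≟_ : DecidableEquality Three
m1 ≟ m1 = yes refl
m1 ≟ z0 = no λ ()
m1 ≟ p1 = no λ ()
z0 ≟ m1 = no λ ()
z0 ≟ z0 = yes refl
z0 ≟ p1 = no λ ()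
p1 ≟ m1 = no λ ()
p1 ≟ z0 = no λ ()
p1 ≟ p1 = yes refl

all? : {P : Three → Set} → Decidable P → Dec (∀ x → P x)
all? P? with P? m1 | P? z0 | P? p1
... | yes pm | yes pz | yes pp = yes λ { m1 → pm ; z0 → pz ; p1 → pp }
... | no ¬pm | _      | _      = no λ p → ¬pm (p m1)
... | yes _  | no ¬pz | _      = no λ p → ¬pz (p z0)
... | yes _  | yes _  | no ¬pp = no λ p → ¬pp (p p1)

-- The element different from a and c when a ≢ c (junk otherwise).
third : Three → Three → Three
third m1 z0 = p1
third z0 m1 = p1
third m1 p1 = z0
third p1 m1 = z0
third _  _  = m1

twoPoint : Three → Three → Three → Three → Three → Three
twoPoint a c a′ c′ x = if does (x ≟ a) then a′ else if does (x ≟ c) then c′ else third a′ c′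

twoPoint-fst : ∀ a c a′ c′ → twoPoint a c a′ c′ a ≡ a′
twoPoint-fst = from-yes (all? λ a → all? λ c → all? λ a′ → all? λ c′ →
  twoPoint a c a′ c′ a ≟ a′)

twoPoint-snd : ∀ a c a′ c′ → a ≢ c → twoPoint a c a′ c′ c ≡ c′
twoPoint-snd = from-yes (all? λ a → all? λ c → all? λ a′ → all? λ c′ →
  ¬? (a ≟ c) →-dec twoPoint a c a′ c′ c ≟ c′)

twoPoint-inverse : ∀ a c a′ c′ → a ≢ c → a′ ≢ c′ →
                   ∀ x → twoPoint a′ c′ a c (twoPoint a c a′ c′ x) ≡ x
twoPoint-inverse = from-yes (all? λ a → all? λ c → all? λ a′ → all? λ c′ →
  ¬? (a ≟ c) →-dec ¬? (a′ ≟ c′) →-dec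
  all? λ x → twoPoint a′ c′ a c (twoPoint a c a′ c′ x) ≟ x)

twoPoint↔ : ∀ {a c a′ c′} → a ≢ c → a′ ≢ c′ → Three ↔ Three
twoPoint↔ {a} {c} {a′} {c′} a≢c a′≢c′ = mk↔ₛ′ (twoPoint a c a′ c′) (twoPoint a′ c′ a c)
  (twoPoint-inverse a′ c′ a c a′≢c′ a≢c) (twoPoint-inverse a c a′ c′ a≢c a′≢c′)

sum≡0⇒≡neg : ∀ x y → val x + val y ≡ 0ℤ → y ≡ neg x
sum≡0⇒≡neg = from-yes (all? λ x → all? λ y → (val x + val y ℤₚ.≟ 0ℤ) →-dec (y ≟ neg x))

≡neg⇒sum≡0 : ∀ {x y} → y ≡ neg x → val x + val y ≡ 0ℤ
≡neg⇒sum≡0 {m1} refl = refl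
≡neg⇒sum≡0 {z0} refl = refl
≡neg⇒sum≡0 {p1} refl = refl

-- The condition x + y ≠ 0 on the edges of L leaving an odd layer, in the form y ≠ −x.
record Compatible (x y : Three) : Set where
  constructor compatible
  field
    ≢neg : y ≢ neg x

compatible-sym : ∀ {x y} → Compatible x y → Compatible y x
compatible-sym {x} {y} (compatible y≢-x) =
  compatible λ x≡-y → y≢-x (trans (sym (neg-involutive y)) (cong neg (sym x≡-y)))

-- A nonzero value not opposite to x: a path may step from x to it and then stay there forever.
pad : Three → Three
pad m1 = m1
pad z0 = p1
pad p1 = p1

pad-compatibleʳ : ∀ x → Compatible x (pad x)
pad-compatibleʳ m1 = compatible λ ()
pad-compatibleʳ z0 = compatible λ ()
pad-compatibleʳ p1 = compatible λ ()

pad-compatible : ∀ x → Compatible (pad x) (pad x)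
pad-compatible m1 = compatible λ ()
pad-compatible z0 = compatible λ ()
pad-compatible p1 = compatible λ ()

odd-edge : ∀ {u v} → Odd (proj₁ u) → E L u v → Compatible (proj₂ u) (proj₂ v)
odd-edge o (_ , inj₁ e)       = ⊥-elim (even⇒¬odd e o)
odd-edge o (_ , inj₂ (_ , c)) = compatible λ y≡-x → c (≡neg⇒sum≡0 y≡-x)

L-edge : ∀ {u v} → proj₁ v ≡ proj₁ u + 1ℤ →
         (Odd (proj₁ u) → Compatible (proj₂ u) (proj₂ v)) → E L u v
L-edge {u} eq c with even-or-odd (proj₁ u)
... | inj₁ e = eq , inj₁ e
... | inj₂ o = eq , inj₂ (o , λ sum≡0 → Compatible.≢neg (c o) (sum≡0⇒≡neg _ _ sum≡0))

-- Layer-shifting automorphisms of L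

record LayerShift (s : ℤ) : Set where
  field
    shift-even : Even s
    perm       : ℤ → Three ↔ Three
    perm-neg   : ∀ i → Odd i → ∀ x → to (perm (i + 1ℤ)) (neg x) ≡ neg (to (perm i) x)

  map : V L → V L
  map (i , x) = i + s , to (perm i) x

  unmap : V L → V L
  unmap (i , x) = i - s , from (perm (i - s)) x

  map-unmap : ∀ u → map (unmap u) ≡ u
  map-unmap (i , x) = cong₂ _,_ (i-j+j≡i i s) (strictlyInverseˡ (perm (i - s)) x)

  unmap-map : ∀ u → unmap (map u) ≡ u
  unmap-map (i , x) = at (i+j-j≡i i s)
    where
    at : ∀ {j} → j ≡ i → (j , from (perm j) (to (perm i) x)) ≡ (i , x)
    at refl = cong (i ,_) (strictlyInverseʳ (perm i) x)

  compatible-perm : ∀ {i x y} → Odd i → Compatible x y →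
                    Compatible (to (perm i) x) (to (perm (i + 1ℤ)) y)
  compatible-perm {i} {x} o (compatible y≢-x) = compatible λ eq →
    y≢-x (Injection.injective (↔⇒↣ (perm (i + 1ℤ))) (trans eq (sym (perm-neg i o x))))

  compatible-unperm : ∀ {i x y} → Odd i →
                      Compatible (to (perm i) x) (to (perm (i + 1ℤ)) y) → Compatible x y
  compatible-unperm {i} {x} o (compatible ≢neg) = compatible λ y≡-x →
    ≢neg (trans (cong (to (perm (i + 1ℤ))) y≡-x) (perm-neg i o x))

  map-edge : ∀ u v → E L u v → E L (map u) (map v)
  map-edge (i , x) (_ , y) (refl , c) = L-edge (+-right-comm i 1ℤ s) λ o →
    let o′ = odd+even-cancel shift-even o in compatible-perm o′ (odd-edge o′ (refl , c))

  map-edge⁻ : ∀ u v → E L (map u) (map v) → E L u v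
  map-edge⁻ (i , x) (j , y) (eq , c) with ∙-cancelʳ s j (i + 1ℤ) (trans eq (+-right-comm i s 1ℤ))
  ... | refl = L-edge refl λ o → compatible-unperm o (odd-edge (odd+even o shift-even) (eq , c))

  automorphism : Automorphism L
  automorphism = record
    { bij      = mk↔ₛ′ map unmap map-unmap unmap-map
    ; preserve = map-edge
    ; reflect  = map-edge⁻
    }

BiPath : (ℤ → Three) → Set
BiPath P = ∀ i → E L (i , P i) (i + 1ℤ , P (i + 1ℤ))

bipath-distinct : ∀ P → BiPath P → ∀ {i} → Odd i → P i ≢ neg (P (i + 1ℤ))
bipath-distinct P P-path {i} o = Compatible.≢neg (compatible-sym (odd-edge o (P-path i)))

-- On an odd layer i the permutation must send P i to Q (i + s), and neg (P (i + 1)), the one vertex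
-- not adjacent to P (i + 1), to neg (Q (i + s + 1)); the even layer i + 1 gets the conjugate by neg.
module _ {s} (s-even : Even s) (P Q : ℤ → Three) (P-path : BiPath P) (Q-path : BiPath Q) where
  private
    open ≡-Reasoning

    σ : ∀ i → Odd i → Three ↔ Three
    σ i o = twoPoint↔ (bipath-distinct P P-path o) (bipath-distinct Q Q-path (odd+even o s-even))

    σ-cong : ∀ {i j} (o : Odd i) (o′ : Odd j) → i ≡ j → ∀ x → to (σ i o) x ≡ to (σ j o′) x
    σ-cong o o′ refl x = refl

    perm : ℤ → Three ↔ Three
    perm i with even-or-odd i
    ... | inj₁ e = neg↔ ↔-∘ (σ (i - 1ℤ) (even+odd e odd-[-1]) ↔-∘ neg↔)
    ... | inj₂ o = σ i o

    perm-neg : ∀ i → Odd i → ∀ x → to (perm (i + 1ℤ)) (neg x) ≡ neg (to (perm i) x)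
    perm-neg i o x with even-or-odd i | even-or-odd (i + 1ℤ)
    ... | inj₁ e  | _       = ⊥-elim (even⇒¬odd e o)
    ... | inj₂ _  | inj₂ o′ = ⊥-elim (even⇒¬odd (odd+odd o odd-1) o′)
    ... | inj₂ o′ | inj₁ e  = cong neg (begin
      to (σ (i + 1ℤ - 1ℤ) o″) (neg (neg x))  ≡⟨ cong (to (σ (i + 1ℤ - 1ℤ) o″)) (neg-involutive x) ⟩
      to (σ (i + 1ℤ - 1ℤ) o″) x              ≡⟨ σ-cong o″ o′ (i+j-j≡i i 1ℤ) x ⟩
      to (σ i o′) x                          ∎)
      where
      o″ = even+odd e odd-[-1]

    perm-path : ∀ i → to (perm i) (P i) ≡ Q (i + s)
    perm-path i with even-or-odd i
    ... | inj₂ o = twoPoint-fst (P i) _ _ _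
    ... | inj₁ e = begin
      neg (to σ′ (neg (P i)))
        ≡⟨ cong (λ j → neg (to σ′ (neg (P j)))) (i-j+j≡i i 1ℤ) ⟨
      neg (to σ′ (neg (P (i - 1ℤ + 1ℤ))))  ≡⟨ cong neg (twoPoint-snd _ _ (Q (i - 1ℤ + s)) _
                                                           (bipath-distinct P P-path o)) ⟩
      neg (neg (Q (i - 1ℤ + s + 1ℤ)))        ≡⟨ neg-involutive _ ⟩
      Q (i - 1ℤ + s + 1ℤ)                    ≡⟨ cong Q (+-right-comm (i - 1ℤ) s 1ℤ) ⟩
      Q (i - 1ℤ + 1ℤ + s)                    ≡⟨ cong (λ j → Q (j + s)) (i-j+j≡i i 1ℤ) ⟩
      Q (i + s)                              ∎
      where
      o = even+odd e odd-[-1]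
      σ′ = σ (i - 1ℤ) o

  bipath-shift : Σ (LayerShift s) λ g → ∀ i → LayerShift.map g (i , P i) ≡ (i + s , Q (i + s))
  bipath-shift = record { shift-even = s-even ; perm = perm ; perm-neg = perm-neg }
               , λ i → cong (i + s ,_) (perm-path i)

-- Walks of L

Walk : ℕ → (ℕ → V L) → Set
Walk n w = ∀ k → k ℕ.< n → E L (w k) (w (suc k))

walk-layer : ∀ {n} w → Walk n w → ∀ k → k ℕ.≤ n → proj₁ (w k) ≡ proj₁ (w 0) + + k
walk-layer w w-walk zero    _   = sym (ℤₚ.+-identityʳ (proj₁ (w 0)))
walk-layer w w-walk (suc k) k<n = begin
  proj₁ (w (suc k))        ≡⟨ proj₁ (w-walk k k<n) ⟩
  proj₁ (w k) + 1ℤ         ≡⟨ cong (_+ 1ℤ) (walk-layer w w-walk k (ℕₚ.<⇒≤ k<n)) ⟩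
  proj₁ (w 0) + + k + 1ℤ   ≡⟨ regroup (proj₁ (w 0)) (+ k) ⟩
  proj₁ (w 0) + + suc k    ∎
  where
  open ≡-Reasoning
  regroup : ∀ a t → a + t + 1ℤ ≡ a + (1ℤ + t)
  regroup = solve-∀

module _ {n} (w : ℕ → V L) (w-walk : Walk n w) where
  private
    a : ℤ
    a = proj₁ (w 0)

    f : ℕ → Three
    f k = proj₂ (w k)

    -- P (a + d) = extend d: the walk for 0 ≤ d ≤ n, padded constantly on both sides.
    extend : ℤ → Three
    extend (+ k) with k ℕ.≤? n
    ... | yes _ = f k
    ... | no _  = pad (f n)
    extend -[1+ _ ] = pad (f 0)

    extend-walk : ∀ k → k ℕ.≤ n → extend (+ k) ≡ f k
    extend-walk k k≤n with k ℕ.≤? n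
    ... | yes _  = refl
    ... | no k≰n = ⊥-elim (k≰n k≤n)

    extend-step⁺ : ∀ k → Odd (a + + k) → Compatible (extend (+ k)) (extend (+ suc k))
    extend-step⁺ k o with k ℕ.≤? n | suc k ℕ.≤? n
    ... | yes _   | yes k<n =
      odd-edge (subst Odd (sym (walk-layer w w-walk k (ℕₚ.<⇒≤ k<n))) o) (w-walk k k<n)
    ... | yes k≤n | no k≮n  =
      subst (λ j → Compatible (f k) (pad (f j))) (ℕₚ.≤∧≮⇒≡ k≤n k≮n) (pad-compatibleʳ (f k))
    ... | no k≰n  | yes k<n = ⊥-elim (k≰n (ℕₚ.<⇒≤ k<n))
    ... | no _    | no _    = pad-compatible (f n)

    extend-step : ∀ d → Odd (a + d) → Compatible (extend d) (extend (d + 1ℤ))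
    extend-step (+ k) o =
      subst (λ e → Compatible (extend (+ k)) (extend e)) (ℤₚ.+-comm 1ℤ (+ k)) (extend-step⁺ k o)
    extend-step -[1+ zero ] _ with 0 ℕ.≤? n
    ... | yes _  = compatible-sym (pad-compatibleʳ (f 0))
    ... | no 0≰n = ⊥-elim (0≰n ℕ.z≤n)
    extend-step -[1+ suc _ ] _ = pad-compatible (f 0)

    P : ℤ → Three
    P i = extend (i - a)

    P-path : BiPath P
    P-path i = L-edge refl λ o →
      subst (λ e → Compatible (P i) (extend e)) (+-right-comm i (- a) 1ℤ)
        (extend-step (i - a) (subst Odd (sym (i+[j-i]≡j a i)) o))

    P-walk : ∀ k → k ℕ.≤ n → P (proj₁ (w k)) ≡ f k
    P-walk k k≤n = begin
      extend (proj₁ (w k) - a)  ≡⟨ cong (λ i → extend (i - a)) (walk-layer w w-walk k k≤n) ⟩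
      extend (a + + k - a)      ≡⟨ cong extend (i+j-i≡j a (+ k)) ⟩
      extend (+ k)              ≡⟨ extend-walk k k≤n ⟩
      f k                       ∎
      where
      open ≡-Reasoning

  walk-extends : Σ (ℤ → Three) λ P → BiPath P × (∀ k → k ℕ.≤ n → P (proj₁ (w k)) ≡ proj₂ (w k))
  walk-extends = P , P-path , P-walk

walk-shift : ∀ {n} w w′ s → Even s → Walk n w → Walk n w′ → proj₁ (w′ 0) ≡ proj₁ (w 0) + s →
             Σ (LayerShift s) λ g → ∀ k → k ℕ.≤ n → LayerShift.map g (w k) ≡ w′ k
walk-shift w w′ s s-even w-walk w′-walk start
  with walk-extends w w-walk | walk-extends w′ w′-walk
... | P , P-path , P-walk | Q , Q-path , Q-walk
  with bipath-shift s-even P Q P-path Q-path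
... | g , g-path = g , λ k k≤n → let i = proj₁ (w k) in begin
  LayerShift.map g (w k)             ≡⟨ cong (λ x → LayerShift.map g (i , x)) (P-walk k k≤n) ⟨
  LayerShift.map g (i , P i)         ≡⟨ g-path i ⟩
  (i + s , Q (i + s))                ≡⟨ cong (λ j → j , Q j) (layer k k≤n) ⟩
  (proj₁ (w′ k) , Q (proj₁ (w′ k)))  ≡⟨ cong (proj₁ (w′ k) ,_) (Q-walk k k≤n) ⟩
  w′ k                               ∎
  where
  open ≡-Reasoning
  layer : ∀ k → k ℕ.≤ _ → proj₁ (w k) + s ≡ proj₁ (w′ k)
  layer k k≤n = begin
    proj₁ (w k) + s         ≡⟨ cong (_+ s) (walk-layer w w-walk k k≤n) ⟩
    proj₁ (w 0) + + k + s   ≡⟨ +-right-comm (proj₁ (w 0)) (+ k) s ⟩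
    proj₁ (w 0) + s + + k   ≡⟨ cong (_+ + k) start ⟨
    proj₁ (w′ 0) + + k      ≡⟨ walk-layer w′ w′-walk k k≤n ⟨
    proj₁ (w′ k)            ∎

-- Automorphisms of D

_⊗_ : Digraph → Digraph → Digraph
G ⊗ H = record { V = V G × V H ; E = λ (a , b) (u , v) → E G a u × E H b v }

_⊗ᵃ_ : ∀ {G H} → Automorphism G → Automorphism H → Automorphism (G ⊗ H)
f ⊗ᵃ g = record
  { bij      = bij f ×-↔ bij g
  ; preserve = λ (a , b) (u , v) (e , e′) → preserve f a u e , preserve g b v e′
  ; reflect  = λ (a , b) (u , v) (e , e′) → reflect f a u e , reflect g b v e′
  }

⊗-swap : ∀ {G} → Automorphism (G ⊗ G)
⊗-swap = record
  { bij      = ×-comm _ _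
  ; preserve = λ _ _ (e , e′) → e′ , e
  ; reflect  = λ _ _ (e , e′) → e′ , e
  }

_∘ᵃ_ : ∀ {G} → Automorphism G → Automorphism G → Automorphism G
f ∘ᵃ g = record
  { bij      = bij f ↔-∘ bij g
  ; preserve = λ x y e → preserve f _ _ (preserve g x y e)
  ; reflect  = λ x y e → reflect g x y (reflect f _ _ e)
  }

identityᵃ : ∀ {G} → Automorphism G
identityᵃ = record { bij = ↔-id _ ; preserve = λ _ _ e → e ; reflect = λ _ _ e → e }

Layered : V (L ⊗ L) → Set
Layered (u , v) = φ¹ u ≡ φ² v

D-vertex-≡ : ∀ {w w′ : V D} → proj₁ w ≡ proj₁ w′ → w ≡ w′
D-vertex-≡ {_ , p} {_ , q} refl = cong (_ ,_) (Decidable⇒UIP.≡-irrelevant ℤₚ._≟_ p q)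

restrict : (Ψ : Automorphism (L ⊗ L)) → (∀ w → Layered (to (bij Ψ) w) ⇔ Layered w) →
           Automorphism D
restrict Ψ layered = record
  { bij      = mk↔ₛ′ to′ from′ (λ (w , _) → D-vertex-≡ (strictlyInverseˡ (bij Ψ) w))
                                (λ (w , _) → D-vertex-≡ (strictlyInverseʳ (bij Ψ) w))
  ; preserve = λ (w , _) (w′ , _) → preserve Ψ w w′
  ; reflect  = λ (w , _) (w′ , _) → reflect Ψ w w′
  }
  where
  to′ : V D → V D
  to′ (w , p) = to (bij Ψ) w , Equivalence.from (layered w) p
  from′ : V D → V D
  from′ (w , p) = from (bij Ψ) w ,
    Equivalence.to (layered (from (bij Ψ) w)) (subst Layered (sym (strictlyInverseˡ (bij Ψ) w)) p)

pair-automorphism : ∀ {t} → LayerShift t → LayerShift t → Automorphism D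
pair-automorphism {t} g h =
  restrict (LayerShift.automorphism g ⊗ᵃ LayerShift.automorphism h) λ ((i , _) , (j , _)) →
    mk⇔ (λ eq → ∙-cancelʳ t i (j + 1ℤ) (trans eq (+-right-comm j t 1ℤ)))
        (λ eq → trans (cong (_+ t) eq) (+-right-comm j 1ℤ t))

swap-automorphism : ∀ {t} → LayerShift (t + 1ℤ) → LayerShift (t - 1ℤ) → Automorphism D
swap-automorphism {t} g h =
  restrict ((LayerShift.automorphism g ⊗ᵃ LayerShift.automorphism h) ∘ᵃ ⊗-swap)
    λ ((i , _) , (j , _)) → mk⇔
      (λ eq → sym (∙-cancelʳ t (j + 1ℤ) i (trans (sym (plus-succ j t)) (trans eq (pred-succ i t)))))
      (λ eq → trans (plus-succ j t) (trans (cong (_+ t) (sym eq)) (sym (pred-succ i t))))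
  where
  plus-succ : ∀ j t → j + (t + 1ℤ) ≡ j + 1ℤ + t
  plus-succ = solve-∀
  pred-succ : ∀ i t → i + (t - 1ℤ) + 1ℤ ≡ i + t
  pred-succ = solve-∀

module _ {G : Digraph} {m : ℕ} (α : Arc G (suc m)) where
  -- The k-th vertex for k ≤ suc m; the no-branch gives the last vertex (and junk beyond it).
  vertex : ℕ → V G
  vertex k with k ℕ.<? suc m
  ... | yes k<n = proj₁ (edge α (Fin.fromℕ< k<n))
  ... | no _    = proj₂ (edge α (Fin.fromℕ m))

  source-vertex : ∀ i → proj₁ (edge α i) ≡ vertex (Fin.toℕ i)
  source-vertex i with Fin.toℕ i ℕ.<? suc m
  ... | yes i<n = cong (λ j → proj₁ (edge α j)) (sym (Finₚ.fromℕ<-toℕ i i<n))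
  ... | no i≮n  = ⊥-elim (i≮n (Finₚ.toℕ<n i))

  target-vertex : ∀ i → proj₂ (edge α i) ≡ vertex (suc (Fin.toℕ i))
  target-vertex i with suc (Fin.toℕ i) ℕ.<? suc m
  ... | yes i+1<n = consec α i (Fin.fromℕ< i+1<n) (Finₚ.toℕ-fromℕ< i+1<n)
  ... | no i+1≮n  =
    cong (λ j → proj₂ (edge α j)) (Finₚ.toℕ-injective (trans i≡m (sym (Finₚ.toℕ-fromℕ m))))
    where
    i≡m : Fin.toℕ i ≡ m
    i≡m = ℕₚ.≤∧≮⇒≡ (ℕₚ.≤-pred (Finₚ.toℕ<n i)) (λ i<m → i+1≮n (ℕ.s≤s i<m))

  vertex-edge : ∀ k → k ℕ.< suc m → E G (vertex k) (vertex (suc k))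
  vertex-edge k k<n = subst (λ j → E G (vertex j) (vertex (suc j))) (Finₚ.toℕ-fromℕ< k<n)
    (subst₂ (E G) (source-vertex i) (target-vertex i) (isEdge α i))
    where
    i = Fin.fromℕ< k<n

maps-by-vertices : ∀ {G m} (f : Automorphism G) (α β : Arc G (suc m)) →
                   (∀ k → k ℕ.≤ suc m → to (bij f) (vertex α k) ≡ vertex β k) → f maps α to β
maps-by-vertices f α β vertex-maps i =
  along (source-vertex α i) (vertex-maps _ (ℕₚ.<⇒≤ (Finₚ.toℕ<n i))) (source-vertex β i) ,
  along (target-vertex α i) (vertex-maps _ (Finₚ.toℕ<n i)) (target-vertex β i)
  where
  along : ∀ {x y u v} → x ≡ u → to (bij f) u ≡ v → y ≡ v → to (bij f) x ≡ y
  along refl fu≡v refl = fu≡v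

module _ {m} (α : Arc D (suc m)) where
  first second : ℕ → V L
  first k  = proj₁ (proj₁ (vertex α k))
  second k = proj₂ (proj₁ (vertex α k))

  first-walk : Walk (suc m) first
  first-walk k k<n = proj₁ (vertex-edge α k k<n)

  second-walk : Walk (suc m) second
  second-walk k k<n = proj₂ (vertex-edge α k k<n)

  first-above-second : proj₁ (first 0) ≡ proj₁ (second 0) + 1ℤ
  first-above-second = proj₂ (vertex α 0)

arc-transitive : ∀ {m} (α β : Arc D (suc m)) → Σ (Automorphism D) λ f → f maps α to β
arc-transitive α β = case even-or-odd t of λ where
    (inj₁ t-even) →
      let (g , g-maps) = walk-shift (first α) (first β) t t-even (first-walk α) (first-walk β)
                           (sym (i+[j-i]≡j a b))
          (h , h-maps) = walk-shift (second α) (second β) t t-even (second-walk α) (second-walk β)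
                           (parallel a a′ b b′ (first-above-second α) (first-above-second β))
      in pair-automorphism g h , maps-by-vertices (pair-automorphism g h) α β λ k k≤n →
           D-vertex-≡ (cong₂ _,_ (g-maps k k≤n) (h-maps k k≤n))
    (inj₂ t-odd) →
      let (g , g-maps) = walk-shift (second α) (first β) (t + 1ℤ) (odd+odd t-odd odd-1)
                           (second-walk α) (first-walk β) (up a a′ b (first-above-second α))
          (h , h-maps) = walk-shift (first α) (second β) (t - 1ℤ) (odd+odd t-odd odd-[-1])
                           (first-walk α) (second-walk β) (down a b b′ (first-above-second β))
      in swap-automorphism {t} g h , maps-by-vertices (swap-automorphism {t} g h) α β λ k k≤n →
           D-vertex-≡ (cong₂ _,_ (g-maps k k≤n) (h-maps k k≤n))
  where
  a a′ b b′ t : ℤ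
  a  = proj₁ (first α 0)
  a′ = proj₁ (second α 0)
  b  = proj₁ (first β 0)
  b′ = proj₁ (second β 0)
  t  = b - a

  parallel : ∀ a a′ b b′ → a ≡ a′ + 1ℤ → b ≡ b′ + 1ℤ → b′ ≡ a′ + (b - a)
  parallel _ a′ _ b′ refl refl = lemma a′ b′
    where
    lemma : ∀ a′ b′ → b′ ≡ a′ + (b′ + 1ℤ - (a′ + 1ℤ))
    lemma = solve-∀

  up : ∀ a a′ b → a ≡ a′ + 1ℤ → b ≡ a′ + ((b - a) + 1ℤ)
  up _ a′ b refl = lemma a′ b
    where
    lemma : ∀ a′ b → b ≡ a′ + ((b - (a′ + 1ℤ)) + 1ℤ)
    lemma = solve-∀

  down : ∀ a b b′ → b ≡ b′ + 1ℤ → b′ ≡ a + ((b - a) - 1ℤ)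
  down a _ b′ refl = lemma a b′
    where
    lemma : ∀ a b′ → b′ ≡ a + ((b′ + 1ℤ - a) - 1ℤ)
    lemma = solve-∀

constant-arc : ∀ n → Arc D n
constant-arc n = record
  { edge   = λ i → p1-vertex (Fin.toℕ i) , p1-vertex (suc (Fin.toℕ i))
  ; isEdge = λ i → p1-step (suc (Fin.toℕ i)) , p1-step (Fin.toℕ i)
  ; consec = λ i j j≡i+1 → cong p1-vertex (sym j≡i+1)
  }
  where
  succ : ∀ k → + suc k ≡ + k + 1ℤ
  succ k = ℤₚ.+-comm 1ℤ (+ k)
  p1-vertex : ℕ → V D
  p1-vertex k = ((+ suc k , p1) , (+ k , p1)) , succ k
  p1-step : ∀ k → E L (+ k , p1) (+ suc k , p1)
  p1-step k = L-edge {+ k , p1} {+ suc k , p1} (succ k) λ _ → compatible λ ()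

mainTheorem2 : HighlyArcTransitive D
mainTheorem2 zero    = constant-arc zero , λ _ _ → identityᵃ , λ ()
mainTheorem2 (suc m) = constant-arc (suc m) , arc-transitive
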